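{- Let $n\geq 2$, fix a dimension $d\in\{0,\dots,n-1\}$, and let $Q[0],Q[1],Q[2]$ be the subgraphs of $Q_n^3$ obtained by partitioning over dimension $d$. Let $F\subseteq V(Q_n^3)$ with $|F|\leq 8n-13$. Put $F_i=F\cap V(Q[i])$ for $i\in\{0,1,2\}$, $I=\{i\in\{0,1,2\}: Q[i]-F_i \text{ is disconnected}\}$, $J=\{0,1,2\}\setminus I$, $F_I=\bigcup_{i\in I}F_i$, $F_J=\bigcup_{j\in J}F_j$, $Q[I]=\bigcup_{i\in I}Q[i]$ and $Q[J]=\bigcup_{j\in J}Q[j]$. Then: (a) if $|I|\leq 2$ and $n\geq 4$, the graph $Q[J]-F_J$ is connected; (b) if $H$ is a component of $Q_n^3-F$ with $V(H)\cap V(Q[J]-F_J)=\emptyset$, then $N_{Q[I]}(H)\subseteq F_I$ and $N_{Q[J]}(H)\subseteq F_J$.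
   Context: The $3$-ary $n$-cube $Q_n^3$ is the graph whose vertices are the strings $u=u_{n-1}u_{n-2}\cdots u_0$ with $u_i\in\{0,1,2\}$, two vertices $u,v$ being adjacent if and only if there is an index $j$ with $u_j=v_j\pm 1 \pmod 3$ and $u_i=v_i$ for all $i\neq j$. Partitioning over dimension $d$: $Q[i]$ ($i=0,1,2$) is the subgraph induced by the vertices $u$ with $u_d=i$ (equivalently, the components obtained by deleting all edges between vertices differing in coordinate $d$); each $Q[i]$ is isomorphic to $Q_{n-1}^3$. For a subgraph $H$, $N_{Q[I]}(H)$ denotes the set of vertices of $Q[I]$ not in $H$ that are adjacent in $Q_n^3$ to some vertex of $H$, and similarly $N_{Q[J]}(H)$. For a subgraph $X$ and vertex set $S$, $X-S$ denotes the subgraph obtained by deleting the vertices of $S$. -}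

module Defs where

open import Data.Nat using (ℕ)
open import Data.Fin using (Fin; zero; suc)
open import Data.Vec using (Vec; lookup)
open import Data.List using (List)
open import Data.List.Membership.Propositional using (_∈_)
open import Data.Product using (Σ; _×_)
open import Data.Sum using (_⊎_)
open import Relation.Nullary using (¬_)
open import Relation.Binary.PropositionalEquality using (_≡_)

Vertex : ℕ → Set
Vertex n = Vec (Fin 3) n

suc3 : Fin 3 → Fin 3
suc3 zero = suc zero
suc3 (suc zero) = suc (suc zero)
suc3 (suc (suc zero)) = zero

Adj : {n : ℕ} → Vertex n → Vertex n → Set
Adj {n} u v = Σ (Fin n) λ j →
  ((lookup u j ≡ suc3 (lookup v j)) ⊎ (lookup v j ≡ suc3 (lookup u j)))
  × (∀ i → ¬ (i ≡ j) → lookup u i ≡ lookup v i)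

data Walk {n : ℕ} (S : Vertex n → Set) : Vertex n → Vertex n → Set where
  here : ∀ {u} → S u → Walk S u u
  step : ∀ {u w v} → S u → Adj u w → Walk S w v → Walk S u v

Connected : {n : ℕ} → (Vertex n → Set) → Set
Connected {n} S = ∀ (u v : Vertex n) → S u → S v → Walk S u v

Alive : {n : ℕ} → List (Vertex n) → Vertex n → Set
Alive F u = ¬ (u ∈ F)

Layer : {n : ℕ} → Fin n → List (Vertex n) → Fin 3 → Vertex n → Set
Layer d F i u = (lookup u d ≡ i) × Alive F u

InI : {n : ℕ} → Fin n → List (Vertex n) → Fin 3 → Set
InI d F i = ¬ Connected (Layer d F i)

InJ : {n : ℕ} → Fin n → List (Vertex n) → Fin 3 → Set
InJ d F j = ¬ InI d F j

QJminusFJ : {n : ℕ} → Fin n → List (Vertex n) → Vertex n → Set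
QJminusFJ d F u = InJ d F (lookup u d) × Alive F u

Component : {n : ℕ} → List (Vertex n) → Vertex n → Vertex n → Set
Component F v u = Walk (Alive F) v u

InNbhd : {n : ℕ} → (Vertex n → Set) → Vertex n → Set
InNbhd {n} H w = ¬ H w × Σ (Vertex n) λ u → H u × Adj u w

-- Part (b) holds for any fault set: a fault-free neighbour of a component of
-- Q_n^3 - F would belong to the component. For part (a) the layers of J are
-- connected by definition, so it suffices to link two of them by a fault-free
-- edge. Deleting coordinate d maps Q_n^3 onto Q_{n-1}^3, and |F| ≤ 8n - 13 < 3^{n-1}
-- leaves some y outside the image of F; the three lifts of y form a fault-free
-- triangle with one vertex in each layer. Since membership in J is a double
-- negation of connectivity, the layer walks are recovered by deciding
-- reachability in the finite graph.
module Submission where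

open import Defs
open import Level using (0ℓ)
open import Data.Nat using (ℕ; zero; suc; _+_; _*_; _∸_; _^_; _≤_; _<_; z≤n; s≤s; _<?_)
open import Data.Nat.Properties
  using (≤-trans; ≤-<-trans; <⇒≱; ≮⇒≥; m≤n⇒m≤1+n; m≤m+n; +-mono-≤; +-monoʳ-≤; +-suc; +-identityʳ;
         m+n∸m≡n; module ≤-Reasoning)
open import Data.Nat.Tactic.RingSolver using (solve-∀)
open import Data.Fin using (Fin; zero; suc; punchOut) renaming (_≟_ to _≟ᶠ_)
open import Data.Fin.Properties using (punchIn-punchOut) renaming (any? to anyᶠ?; all? to allᶠ?)
open import Data.Vec using ([]; _∷_; lookup; insertAt; removeAt)
open import Data.Vec.Properties using (≡-dec; insertAt-lookup; insertAt-punchIn; removeAt-insertAt)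
open import Data.List using (List; []; _∷_; length; map; filter; allFin; cartesianProductWith)
open import Data.List.Properties using (length-filter; length-map)
open import Data.List.Membership.Propositional using (_∈_)
open import Data.List.Membership.Propositional.Properties using (∈-map⁺; ∈-allFin; ∈-cartesianProductWith⁺)
import Data.List.Membership.DecPropositional as DecMembership
open import Data.List.Relation.Unary.Any using (Any; here; there; any?; satisfied)
import Data.List.Relation.Unary.Any as Any
open import Data.List.Relation.Unary.All using (All; all?; []; _∷_)
import Data.List.Relation.Unary.All as All
open import Data.Product using (Σ; ∃; _×_; _,_; proj₁; proj₂)
open import Data.Sum using (_⊎_; inj₁; inj₂)
open import Data.Empty using (⊥-elim)
open import Function using (_∘_)
open import Relation.Nullary using (¬_; Dec; yes; no; Stable)
open import Relation.Nullary.Decidable using (¬?; _×-dec_; _⊎-dec_; _→-dec_; decidable-stable)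
open import Relation.Unary using (Pred; Decidable; _⊆_)
open import Relation.Binary.PropositionalEquality using (_≡_; _≢_; refl; sym; trans; cong; subst; ≢-sym)

walk-map : ∀ {n} {S T : Pred (Vertex n) 0ℓ} → S ⊆ T → ∀ {a b} → Walk S a b → Walk T a b
walk-map S⊆T (here s)     = here (S⊆T s)
walk-map S⊆T (step s e w) = step (S⊆T s) e (walk-map S⊆T w)

_◅◅_ : ∀ {n} {S : Pred (Vertex n) 0ℓ} {a b c} → Walk S a b → Walk S b c → Walk S a c
here _     ◅◅ w′ = w′
step s e w ◅◅ w′ = step s e (w ◅◅ w′)

_▻_ : ∀ {n} {S : Pred (Vertex n) 0ℓ} {a b c} → Walk S a b → S c × Adj b c → Walk S a c
here s     ▻ (sc , e) = step s e (here sc)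
step s e w ▻ last     = step s e (w ▻ last)

vertices : ∀ n → List (Vertex n)
vertices zero    = [] ∷ []
vertices (suc n) = cartesianProductWith _∷_ (allFin 3) (vertices n)

∈-vertices : ∀ {n} (x : Vertex n) → x ∈ vertices n
∈-vertices []      = here refl
∈-vertices (a ∷ x) = ∈-cartesianProductWith⁺ _∷_ (∈-allFin a) (∈-vertices x)

_≟ᵛ_ : ∀ {n} (x y : Vertex n) → Dec (x ≡ y)
_≟ᵛ_ = ≡-dec _≟ᶠ_

_∈ᵛ?_ : ∀ {n} (x : Vertex n) (L : List (Vertex n)) → Dec (x ∈ L)
_∈ᵛ?_ = DecMembership._∈?_ _≟ᵛ_

Adj? : ∀ {n} (u v : Vertex n) → Dec (Adj u v)
Adj? u v = anyᶠ? λ j →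
  ((lookup u j ≟ᶠ suc3 (lookup v j)) ⊎-dec (lookup v j ≟ᶠ suc3 (lookup u j)))
  ×-dec allᶠ? (λ i → ¬? (i ≟ᶠ j) →-dec (lookup u i ≟ᶠ lookup v i))

module _ {A : Set} {P Q : Pred A 0ℓ} (P? : Decidable P) (Q? : Decidable Q) (P⊆Q : P ⊆ Q) where

  length-filter-mono : ∀ xs → length (filter P? xs) ≤ length (filter Q? xs)
  length-filter-mono []       = z≤n
  length-filter-mono (x ∷ xs) with P? x | Q? x
  ... | yes _  | yes _  = s≤s (length-filter-mono xs)
  ... | yes px | no ¬qx = ⊥-elim (¬qx (P⊆Q px))
  ... | no _   | yes _  = m≤n⇒m≤1+n (length-filter-mono xs)
  ... | no _   | no _   = length-filter-mono xs

  length-filter-strict : ∀ xs → ¬ All (λ x → Q x → P x) xs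
                       → length (filter P? xs) < length (filter Q? xs)
  length-filter-strict []       Q⊈P = ⊥-elim (Q⊈P [])
  length-filter-strict (x ∷ xs) Q⊈P with P? x | Q? x
  ... | yes px | yes _  = s≤s (length-filter-strict xs (Q⊈P ∘ ((λ _ → px) ∷_)))
  ... | yes px | no ¬qx = ⊥-elim (¬qx (P⊆Q px))
  ... | no _   | yes _  = s≤s (length-filter-mono xs)
  ... | no _   | no ¬qx = length-filter-strict xs (Q⊈P ∘ ((⊥-elim ∘ ¬qx) ∷_))

-- The sets of vertices joined to v within k steps increase with k; once one
-- step adds nothing they are constant, and this must happen within |V| steps.
module Reachability {n} {S : Pred (Vertex n) 0ℓ} (S? : Decidable S) (v : Vertex n) where

  -- The next vertex is taken from the enumeration so that Reaches k is decidable.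
  Reaches : ℕ → Pred (Vertex n) 0ℓ
  Reaches zero    x = x ≡ v × S x
  Reaches (suc k) x = Reaches k x ⊎ (S x × Any (λ y → Adj x y × Reaches k y) (vertices n))

  reaches? : ∀ k → Decidable (Reaches k)
  reaches? zero    x = (x ≟ᵛ v) ×-dec S? x
  reaches? (suc k) x = reaches? k x ⊎-dec (S? x ×-dec any? (λ y → Adj? x y ×-dec reaches? k y) (vertices n))

  reaches⇒walk : ∀ k {x} → Reaches k x → Walk S x v
  reaches⇒walk zero    (refl , s)         = here s
  reaches⇒walk (suc k) (inj₁ r)           = reaches⇒walk k r
  reaches⇒walk (suc k) (inj₂ (s , next)) with satisfied next
  ... | _ , e , r = step s e (reaches⇒walk k r)

  walk⇒reaches : ∀ {x} → Walk S x v → ∃ λ k → Reaches k x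
  walk⇒reaches (here s) = zero , refl , s
  walk⇒reaches (step {w = y} s e w) with walk⇒reaches w
  ... | k , r = suc k , inj₂ (s , Any.map (λ { refl → e , r }) (∈-vertices y))

  reaches-start : ∀ k → Reaches zero ⊆ Reaches k
  reaches-start zero    r = r
  reaches-start (suc k) r = inj₁ (reaches-start k r)

  Closed : ℕ → Set
  Closed k = Reaches (suc k) ⊆ Reaches k

  closed⇒saturated : ∀ {k} → Closed k → ∀ m → Reaches m ⊆ Reaches k
  closed⇒saturated {k} _  zero    r                 = reaches-start k r
  closed⇒saturated closed (suc m) (inj₁ r)          = closed⇒saturated closed m r
  closed⇒saturated closed (suc m) (inj₂ (s , next)) =
    closed (inj₂ (s , Any.map (λ { (e , r) → e , closed⇒saturated closed m r }) next))

  reached : ℕ → ℕ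
  reached k = length (filter (reaches? k) (vertices n))

  closed-or-grows : ∀ k → Closed k ⊎ reached k < reached (suc k)
  closed-or-grows k with all? (λ x → reaches? (suc k) x →-dec reaches? k x) (vertices n)
  ... | yes closed = inj₁ λ {x} → All.lookup closed (∈-vertices x)
  ... | no ¬closed = inj₂ (length-filter-strict (reaches? k) (reaches? (suc k)) inj₁ (vertices n) ¬closed)

  saturated-or-large : ∀ k → (∀ m → Reaches m ⊆ Reaches k) ⊎ k ≤ reached k
  saturated-or-large zero = inj₂ z≤n
  saturated-or-large (suc k) with saturated-or-large k
  ... | inj₁ saturated = inj₁ λ m → inj₁ ∘ saturated m
  ... | inj₂ large with closed-or-grows k
  ...   | inj₁ closed = inj₁ λ m → inj₁ ∘ closed⇒saturated closed m
  ...   | inj₂ grows  = inj₂ (≤-<-trans large grows)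

  saturation : ∀ m → Reaches m ⊆ Reaches (suc (length (vertices n)))
  saturation with saturated-or-large (suc (length (vertices n)))
  ... | inj₁ saturated = saturated
  ... | inj₂ large     = ⊥-elim (<⇒≱ (s≤s (length-filter _ (vertices n))) large)

  walk? : Decidable (λ x → Walk S x v)
  walk? x with reaches? (suc (length (vertices n))) x
  ... | yes r = yes (reaches⇒walk _ r)
  ... | no ¬r = no λ w → let k , r = walk⇒reaches w in ¬r (saturation k r)

Connected-stable : ∀ {n} {S : Pred (Vertex n) 0ℓ} → Decidable S → Stable (Connected S)
Connected-stable S? ¬¬connected u v su sv =
  decidable-stable (Reachability.walk? S? v u) λ ¬walk → ¬¬connected λ connected → ¬walk (connected u v su sv)

component-neighbour∈F : ∀ {n} (F : List (Vertex n)) v w → InNbhd (Component F v) w → w ∈ F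
component-neighbour∈F F v w (w∉H , u , v⇝u , e) =
  decidable-stable (w ∈ᵛ? F) λ w∉F → w∉H (v⇝u ▻ (w∉F , e))

module _ {n} (d : Fin n) (F : List (Vertex n)) where

  Layer? : ∀ i → Decidable (Layer d F i)
  Layer? i x = (lookup x d ≟ᶠ i) ×-dec ¬? (x ∈ᵛ? F)

  J-layer⊆QJminusFJ : ∀ {j} → InJ d F j → Layer d F j ⊆ QJminusFJ d F
  J-layer⊆QJminusFJ j∈J (refl , x∉F) = j∈J , x∉F

  J-layer-walk : ∀ {j a b} → InJ d F j → Layer d F j a → Layer d F j b → Walk (QJminusFJ d F) a b
  J-layer-walk {j} {a} {b} j∈J a∈Qj b∈Qj =
    walk-map (J-layer⊆QJminusFJ j∈J) (Connected-stable (Layer? j) j∈J a b a∈Qj b∈Qj)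

column : ∀ {m} → Fin 3 → List (Vertex (suc m)) → List (Vertex m)
column k []             = []
column k ((a ∷ y) ∷ L) with a ≟ᶠ k
... | yes _ = y ∷ column k L
... | no _  = column k L

∈-column : ∀ {m} k {y : Vertex m} {L} → (k ∷ y) ∈ L → y ∈ column k L
∈-column k {L = (.k ∷ _) ∷ L} (here refl) with k ≟ᶠ k
... | yes _   = here refl
... | no k≢k = ⊥-elim (k≢k refl)
∈-column k {L = (a ∷ _) ∷ L} (there k∷y∈L) with a ≟ᶠ k
... | yes _ = there (∈-column k k∷y∈L)
... | no _  = ∈-column k k∷y∈L

column-lengths : ∀ {m} (L : List (Vertex (suc m)))
               → length (column zero L) + (length (column (suc zero) L) + length (column (suc (suc zero)) L))
                 ≤ length L
column-lengths [] = z≤n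
column-lengths ((zero ∷ _) ∷ L) = s≤s (column-lengths L)
column-lengths ((suc zero ∷ _) ∷ L)
  rewrite +-suc (length (column zero L)) (length (column (suc zero) L) + length (column (suc (suc zero)) L))
  = s≤s (column-lengths L)
column-lengths ((suc (suc zero) ∷ _) ∷ L)
  rewrite +-suc (length (column (suc zero) L)) (length (column (suc (suc zero)) L))
        | +-suc (length (column zero L)) (length (column (suc zero) L) + length (column (suc (suc zero)) L))
  = s≤s (column-lengths L)

short-column : ∀ {m} (L : List (Vertex (suc m)))
             → length L < 3 ^ suc m → ∃ λ k → length (column k L) < 3 ^ m
short-column {m} L |L|< with length (column zero L) <? 3 ^ m
... | yes short = zero , short
... | no long₀ with length (column (suc zero) L) <? 3 ^ m
...   | yes short = suc zero , short
...   | no long₁ with length (column (suc (suc zero)) L) <? 3 ^ m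
...     | yes short = suc (suc zero) , short
...     | no long₂ = ⊥-elim (<⇒≱ |L|< (begin
  3 ^ suc m                        ≡⟨ cong (λ t → 3 ^ m + (3 ^ m + t)) (+-identityʳ (3 ^ m)) ⟩
  3 ^ m + (3 ^ m + 3 ^ m)          ≤⟨ +-mono-≤ (≮⇒≥ long₀) (+-mono-≤ (≮⇒≥ long₁) (≮⇒≥ long₂)) ⟩
  length (column zero L) + (length (column (suc zero) L) + length (column (suc (suc zero)) L))
                                   ≤⟨ column-lengths L ⟩
  length L                         ∎))
  where open ≤-Reasoning

missing-vertex : ∀ m (L : List (Vertex m)) → length L < 3 ^ m → ∃ λ y → ¬ y ∈ L
missing-vertex zero    []      _          = [] , λ ()
missing-vertex zero    (_ ∷ _) (s≤s ())
missing-vertex (suc m) L       |L|<3^[1+m] with short-column L |L|<3^[1+m]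
... | k , short with missing-vertex m (column k L) short
...   | y , y∉column = (k ∷ y) , y∉column ∘ ∈-column k

≢⇒suc3-related : ∀ {a b : Fin 3} → a ≢ b → a ≡ suc3 b ⊎ b ≡ suc3 a
≢⇒suc3-related {zero}             {zero}             a≢b = ⊥-elim (a≢b refl)
≢⇒suc3-related {zero}             {suc zero}         _   = inj₂ refl
≢⇒suc3-related {zero}             {suc (suc zero)}   _   = inj₁ refl
≢⇒suc3-related {suc zero}         {zero}             _   = inj₁ refl
≢⇒suc3-related {suc zero}         {suc zero}         a≢b = ⊥-elim (a≢b refl)
≢⇒suc3-related {suc zero}         {suc (suc zero)}   _   = inj₂ refl
≢⇒suc3-related {suc (suc zero)}   {zero}             _   = inj₂ refl
≢⇒suc3-related {suc (suc zero)}   {suc zero}         _   = inj₁ refl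
≢⇒suc3-related {suc (suc zero)}   {suc (suc zero)}   a≢b = ⊥-elim (a≢b refl)

insertAt-lookup-≢ : ∀ {m} (y : Vertex m) d a {i} (d≢i : d ≢ i)
                  → lookup (insertAt y d a) i ≡ lookup y (punchOut d≢i)
insertAt-lookup-≢ y d a d≢i =
  subst (λ i → lookup (insertAt y d a) i ≡ lookup y (punchOut d≢i))
        (punchIn-punchOut d≢i) (insertAt-punchIn y d a (punchOut d≢i))

insertAt-Adj : ∀ {m} (y : Vertex m) d {a b} → a ≢ b → Adj (insertAt y d a) (insertAt y d b)
insertAt-Adj y d {a} {b} a≢b = d , across , λ i i≢d →
  trans (insertAt-lookup-≢ y d a (≢-sym i≢d)) (sym (insertAt-lookup-≢ y d b (≢-sym i≢d)))
  where
  across : lookup (insertAt y d a) d ≡ suc3 (lookup (insertAt y d b) d)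
         ⊎ lookup (insertAt y d b) d ≡ suc3 (lookup (insertAt y d a) d)
  across rewrite insertAt-lookup y d a | insertAt-lookup y d b = ≢⇒suc3-related a≢b

insertAt-Layer : ∀ {m} d (F : List (Vertex (suc m))) {y} → ¬ y ∈ map (λ x → removeAt x d) F
               → ∀ a → Layer d F a (insertAt y d a)
insertAt-Layer d F {y} y∉F′ a = insertAt-lookup y d a , λ x∈F →
  y∉F′ (subst (_∈ map (λ x → removeAt x d) F) (removeAt-insertAt y d a) (∈-map⁺ (λ x → removeAt x d) x∈F))

Connected-QJminusFJ : ∀ {n} (d : Fin n) (F : List (Vertex n))
                    → length F < 3 ^ (n ∸ 1) → Connected (QJminusFJ d F)
Connected-QJminusFJ {suc m} d F |F|< u v (u∈J , u∉F) (v∈J , v∉F) with lookup u d ≟ᶠ lookup v d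
... | yes same = J-layer-walk d F u∈J (refl , u∉F) (sym same , v∉F)
... | no differ =
  J-layer-walk d F u∈J (refl , u∉F) (lift (lookup u d))
  ◅◅ step (J-layer⊆QJminusFJ d F u∈J (lift (lookup u d))) (insertAt-Adj y d differ)
       (J-layer-walk d F v∈J (lift (lookup v d)) (refl , v∉F))
  where
  F′ : List (Vertex m)
  F′ = map (λ x → removeAt x d) F
  y∉F′ : ∃ λ y → ¬ y ∈ F′
  y∉F′ = missing-vertex m F′ (subst (_< 3 ^ m) (sym (length-map _ F)) |F|<)
  y : Vertex m
  y = proj₁ y∉F′
  lift : ∀ a → Layer d F a (insertAt y d a)
  lift = insertAt-Layer d F (proj₂ y∉F′)

20+8k≤3^[3+k] : ∀ k → 20 + 8 * k ≤ 3 ^ (3 + k)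
20+8k≤3^[3+k] zero    = m≤m+n 20 7
20+8k≤3^[3+k] (suc k) = begin
  20 + 8 * suc k         ≡⟨ shift k ⟩
  (20 + 8 * k) + 8       ≤⟨ +-mono-≤ ih (≤-trans (m≤m+n 8 (12 + 8 * k)) ih) ⟩
  p + p                  ≤⟨ +-monoʳ-≤ p (m≤m+n p (p + 0)) ⟩
  p + (p + (p + 0))      ∎
  where
  open ≤-Reasoning
  p : ℕ
  p = 3 ^ (3 + k)
  ih : 20 + 8 * k ≤ p
  ih = 20+8k≤3^[3+k] k
  shift : ∀ k → 20 + 8 * suc k ≡ (20 + 8 * k) + 8
  shift = solve-∀

8n∸13<3^[n∸1] : ∀ {n} → 4 ≤ n → 8 * n ∸ 13 < 3 ^ (n ∸ 1)
8n∸13<3^[n∸1] (s≤s (s≤s (s≤s (s≤s {n = k} _)))) = begin-strict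
  8 * (4 + k) ∸ 13            ≡⟨ cong (_∸ 13) (expand k) ⟩
  13 + (19 + 8 * k) ∸ 13      ≡⟨ m+n∸m≡n 13 (19 + 8 * k) ⟩
  19 + 8 * k                  <⟨ 20+8k≤3^[3+k] k ⟩
  3 ^ (3 + k)                 ∎
  where
  open ≤-Reasoning
  expand : ∀ k → 8 * (4 + k) ≡ 13 + (19 + 8 * k)
  expand = solve-∀

lemma3p6 : (n : ℕ) → 2 ≤ n → (d : Fin n) → (F : List (Vertex n))
    → length F ≤ 8 * n ∸ 13
    → ((Σ (Fin 3) λ j → InJ d F j) → 4 ≤ n → Connected (QJminusFJ d F))
      × ((v : Vertex n) → Alive F v
         → (∀ u → Component F v u → ¬ QJminusFJ d F u)
         → (∀ w → InI d F (lookup w d) → InNbhd (Component F v) w → w ∈ F)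
           × (∀ w → InJ d F (lookup w d) → InNbhd (Component F v) w → w ∈ F))
lemma3p6 n _ d F |F|≤ =
  (λ _ 4≤n → Connected-QJminusFJ d F (≤-<-trans |F|≤ (8n∸13<3^[n∸1] 4≤n))) ,
  λ v _ _ → (λ w _ → component-neighbour∈F F v w) , (λ w _ → component-neighbour∈F F v w)
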